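{- Let $k\geq 2$ and $n\geq m\geq 3$ be integers, and let the edges of the complete $k$-uniform hypergraph $\mathcal{K}^k_{(k-1)n+\lfloor\frac{m+1}{2}\rfloor}$ be colored red and blue. If the red edges contain a copy of the loose cycle $\mathcal{C}^k_n$, then either the red edges contain a copy of the loose path $\mathcal{P}^k_n$ or the blue edges contain a copy of the loose path $\mathcal{P}^k_m$.
   Context: The $k$-uniform loose cycle $\mathcal{C}^k_n$ has vertex set $\{v_1,\dots,v_{n(k-1)}\}$ and the $n$ edges $e_i=\{v_{1+i(k-1)},\dots,v_{k+i(k-1)}\}$, $i=0,\dots,n-1$, with indices taken modulo $n(k-1)$. The $k$-uniform loose path $\mathcal{P}^k_n$ has vertex set $\{v_1,\dots,v_{n(k-1)+1}\}$ and the $n$ edges $e_i=\{v_{1+i(k-1)},\dots,v_{k+i(k-1)}\}$, $i=0,\dots,n-1$. -}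

module Defs where

open import Data.Nat using (ℕ; zero; suc; _+_; _*_; _∸_; _<_)
open import Data.Nat.DivMod using (_%_)
open import Data.Fin using (Fin)
open import Data.Fin.Subset using (Subset; ⊥; ⁅_⁆; _∪_)
open import Data.Product using (Σ; _×_)
open import Relation.Binary.PropositionalEquality using (_≡_)

data Colour : Set where
  red blue : Colour

-- A 2-colouring of the edges of the complete k-uniform hypergraph on the
-- vertex set Fin N: a colour for every subset of Fin N (only the values on
-- k-element subsets are ever used below).
Colouring : ℕ → Set
Colouring N = Subset N → Colour

-- genuine "j mod L" (with the convention j mod 0 = j, never used since L ≥ 1)
modN : ℕ → ℕ → ℕ
modN zero    j = j
modN (suc L) j = j % suc L

image : ∀ {N} → (ℕ → Fin N) → (ℕ → ℕ) → ℕ → Subset N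
image f g zero    = ⊥
image f g (suc t) = ⁅ f (g t) ⁆ ∪ image f g t

InjectiveBelow : ∀ {N} → ℕ → (ℕ → Fin N) → Set
InjectiveBelow L f = ∀ i j → i < L → j < L → f i ≡ f j → i ≡ j

-- Vertices of C^k_n are 0,…,n(k-1)-1 (0-indexed v_{j+1} ↦ j); edge e_i, i < n,
-- is { (i(k-1)+t) mod n(k-1) : t < k }.
HasLooseCycle : ∀ {N} → Colouring N → Colour → (k n : ℕ) → Set
HasLooseCycle {N} c col k n =
  Σ (ℕ → Fin N) λ f →
    InjectiveBelow (n * (k ∸ 1)) f ×
    (∀ i → i < n →
      c (image f (λ t → modN (n * (k ∸ 1)) (i * (k ∸ 1) + t)) k) ≡ col)

HasLoosePath : ∀ {N} → Colouring N → Colour → (k n : ℕ) → Set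
HasLoosePath {N} c col k n =
  Σ (ℕ → Fin N) λ f →
    InjectiveBelow (suc (n * (k ∸ 1))) f ×
    (∀ i → i < n → c (image f (λ t → i * (k ∸ 1) + t) k) ≡ col)

module Submission where

open import Defs
open import Data.Nat using (ℕ; zero; suc; _+_; _*_; _∸_; _≤_; _<_; _/_; _%_; z≤n; s≤s; s≤s⁻¹; z<s; NonZero; >-nonZero; >-nonZero⁻¹; _≟_; _<?_; _≤?_)
open import Data.Nat.Properties
open import Data.Nat.DivMod
open import Data.Nat.Divisibility using (divides-refl)
open import Data.Nat.Tactic.RingSolver using (solve-∀)
open import Data.Fin using (Fin; toℕ; fromℕ<)
import Data.Fin.Properties as Fin
open import Data.Fin.Subset using (Subset; ⁅_⁆; _∪_; _∈_; _⊆_)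
open import Data.Fin.Subset.Properties using (⊆-antisym; x∈p∪q⁻; x∈p∪q⁺; x∈⁅y⁆⇒x≡y; x∈⁅x⁆; ∉⊥)
open import Data.Product using (Σ; _×_; _,_; proj₁; proj₂)
open import Data.Sum using (_⊎_; inj₁; inj₂; [_,_]′)
open import Data.Empty using (⊥-elim)
open import Function using (_∘_)
open import Relation.Nullary using (yes; no)
open import Relation.Binary.Definitions using (tri<; tri≈; tri>)
open import Relation.Binary.PropositionalEquality

-- Let d = k - 1, L = n·d and p = ⌊(m+1)/2⌋.  The red loose cycle C^k_n uses L of the
-- L + p vertices; first its vertex map is extended injectively by p fresh vertices.
--  (1) Opening the cycle.  If a cycle edge e_t with one endpoint replaced by a fresh vertex
--      is red, cutting the cycle at that endpoint and attaching the fresh vertex gives a red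
--      loose path P^k_n (module OpenCycle: red-path-first, red-path-last).
--  (2) Weaving.  The candidate P^k_m follows the cycle from vertex 0, except that the joint
--      of e_{2i} and e_{2i+1} is replaced by the fresh vertex L + i and, for even m, the end
--      vertex m·d by the vacated joint (m-1)·d.  It is injective (it has a left inverse) and
--      each of its edges is, as a set, a cycle edge with one endpoint replaced by a fresh
--      vertex (module Weave).
-- So either every edge of the candidate is blue, giving a blue P^k_m, or one is red and (1)
-- gives a red P^k_n.

image-cong : ∀ {N} (F F' : ℕ → Fin N) (G G' : ℕ → ℕ) k →
  (∀ s → s < k → F (G s) ≡ F' (G' s)) → image F G k ≡ image F' G' k
image-cong F F' G G' zero    _  = refl
image-cong F F' G G' (suc k) eq =
  cong₂ (λ v E → ⁅ v ⁆ ∪ E) (eq k ≤-refl)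
        (image-cong F F' G G' k (λ s s<k → eq s (m<n⇒m<1+n s<k)))

∈-image⁻ : ∀ {N} (F : ℕ → Fin N) G k {x} → x ∈ image F G k →
  Σ ℕ λ s → s < k × F (G s) ≡ x
∈-image⁻ F G zero    x∈ = ⊥-elim (∉⊥ x∈)
∈-image⁻ F G (suc k) x∈ with x∈p∪q⁻ ⁅ F (G k) ⁆ (image F G k) x∈
... | inj₁ x∈⁅v⁆ = k , ≤-refl , sym (x∈⁅y⁆⇒x≡y (F (G k)) x∈⁅v⁆)
... | inj₂ x∈E with ∈-image⁻ F G k x∈E
...   | s , s<k , eq = s , m<n⇒m<1+n s<k , eq

∈-image⁺ : ∀ {N} (F : ℕ → Fin N) G k {s} → s < k → F (G s) ∈ image F G k
∈-image⁺ F G (suc k) {s} s<1+k with m≤n⇒m<n∨m≡n (s≤s⁻¹ s<1+k)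
... | inj₁ s<k  = x∈p∪q⁺ (inj₂ (∈-image⁺ F G k s<k))
... | inj₂ refl = x∈p∪q⁺ (inj₁ (x∈⁅x⁆ _))

PositionsCovered : ℕ → (ℕ → ℕ) → (ℕ → ℕ) → Set
PositionsCovered k G G' = ∀ s → s < k → Σ ℕ λ s' → s' < k × G s ≡ G' s'

image-⊆ : ∀ {N} (F : ℕ → Fin N) G G' k → PositionsCovered k G G' →
  image F G k ⊆ image F G' k
image-⊆ F G G' k covered x∈ with ∈-image⁻ F G k x∈
... | s , s<k , refl with covered s s<k
...   | s' , s'<k , eq = subst (_∈ image F G' k) (cong F (sym eq)) (∈-image⁺ F G' k s'<k)

image-≡ : ∀ {N} (F : ℕ → Fin N) G G' k →
  PositionsCovered k G G' → PositionsCovered k G' G → image F G k ≡ image F G' k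
image-≡ F G G' k cov cov' = ⊆-antisym (image-⊆ F G G' k cov) (image-⊆ F G' G k cov')

missed-vertex : ∀ {N} a (F : ℕ → Fin N) → InjectiveBelow a F → a < N →
  Σ (Fin N) λ x → ∀ j → j < a → F j ≢ x
missed-vertex {N} a F injF a<N with Fin.all? (λ x → Fin.any? (λ (i : Fin a) → F (toℕ i) Fin.≟ x))
... | yes allHit = ⊥-elim (<⇒≱ a<N (Fin.injective⇒≤ preimage-injective))
  where
  preimage : Fin N → Fin a
  preimage x = proj₁ (allHit x)
  preimage-injective : ∀ {x y} → preimage x ≡ preimage y → x ≡ y
  preimage-injective {x} {y} eq =
    trans (sym (proj₂ (allHit x))) (trans (cong (F ∘ toℕ) eq) (proj₂ (allHit y)))
... | no notAllHit with Fin.¬∀⟶∃¬ N _ (λ x → Fin.any? (λ (i : Fin a) → F (toℕ i) Fin.≟ x)) notAllHit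
...   | x , notHit = x , λ j j<a eq → notHit (fromℕ< j<a , trans (cong F (Fin.toℕ-fromℕ< j<a)) eq)

extend-injective₁ : ∀ {N} a (F : ℕ → Fin N) → InjectiveBelow a F → a < N →
  Σ (ℕ → Fin N) λ F' → InjectiveBelow (suc a) F' × (∀ j → j < a → F' j ≡ F j)
extend-injective₁ {N} a F injF a<N = F' , injF' , agree
  where
  x : Fin N
  x = proj₁ (missed-vertex a F injF a<N)
  F' : ℕ → Fin N
  F' j with j ≟ a
  ... | yes _ = x
  ... | no  _ = F j
  agree : ∀ j → j < a → F' j ≡ F j
  agree j j<a with j ≟ a
  ... | yes refl = ⊥-elim (<-irrefl refl j<a)
  ... | no  _    = refl
  missed : ∀ j → j < a → F j ≢ x
  missed = proj₂ (missed-vertex a F injF a<N)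
  injF' : InjectiveBelow (suc a) F'
  injF' i j i≤a j≤a eq with i ≟ a | j ≟ a
  ... | yes i≡a | yes j≡a = trans i≡a (sym j≡a)
  ... | yes _    | no j≢a  = ⊥-elim (missed j (≤∧≢⇒< (s≤s⁻¹ j≤a) j≢a) (sym eq))
  ... | no i≢a  | yes _    = ⊥-elim (missed i (≤∧≢⇒< (s≤s⁻¹ i≤a) i≢a) eq)
  ... | no i≢a  | no j≢a  =
    injF i j (≤∧≢⇒< (s≤s⁻¹ i≤a) i≢a) (≤∧≢⇒< (s≤s⁻¹ j≤a) j≢a) eq

extend-injective : ∀ {N} a p (F : ℕ → Fin N) → InjectiveBelow a F → a + p ≤ N →
  Σ (ℕ → Fin N) λ F' → InjectiveBelow (a + p) F' × (∀ j → j < a → F' j ≡ F j)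
extend-injective a zero F injF _ =
  F , subst (λ b → InjectiveBelow b F) (sym (+-identityʳ a)) injF , λ _ _ → refl
extend-injective {N} a (suc p) F injF a+1+p≤N
  with extend-injective₁ a F injF (<-≤-trans (m<m+n a z<s) a+1+p≤N)
... | F₁ , injF₁ , agree₁ with extend-injective (suc a) p F₁ injF₁ (subst (_≤ N) (+-suc a p) a+1+p≤N)
...   | F₂ , injF₂ , agree₂ =
  F₂ , subst (λ b → InjectiveBelow b F₂) (sym (+-suc a p)) injF₂ ,
  λ j j<a → trans (agree₂ j (m<n⇒m<1+n j<a)) (agree₁ j j<a)

InjectiveOn : ℕ → (ℕ → ℕ) → Set
InjectiveOn a π = ∀ i j → i < a → j < a → π i ≡ π j → i ≡ j

left-inverse⇒injective : ∀ {a} (π ρ : ℕ → ℕ) → (∀ j → j < a → ρ (π j) ≡ j) →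
  InjectiveOn a π
left-inverse⇒injective π ρ inv i j i<a j<a eq =
  trans (sym (inv i i<a)) (trans (cong ρ eq) (inv j j<a))

∘-injective : ∀ {N a B} (F : ℕ → Fin N) (π : ℕ → ℕ) → InjectiveBelow B F →
  (∀ j → j < a → π j < B) → InjectiveOn a π → InjectiveBelow a (F ∘ π)
∘-injective F π injF bound injπ i j i<a j<a eq = injπ i j i<a j<a (injF _ _ (bound i i<a) (bound j j<a) eq)

quotient-gap : ∀ L .{{_ : NonZero L}} x y → x % L ≡ y % L → x / L < y / L → x + L ≤ y
quotient-gap L x y same-rem x/L<y/L = begin
  x + L                   ≡⟨ cong (_+ L) (m≡m%n+[m/n]*n x L) ⟩
  x % L + x / L * L + L    ≡⟨ +-assoc (x % L) _ L ⟩
  x % L + (x / L * L + L) ≡⟨ cong (x % L +_) (+-comm (x / L * L) L) ⟩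
  x % L + suc (x / L) * L ≤⟨ +-mono-≤ (≤-reflexive same-rem) (*-monoˡ-≤ L x/L<y/L) ⟩
  y % L + y / L * L       ≡⟨ sym (m≡m%n+[m/n]*n y L) ⟩
  y                       ∎
  where open ≤-Reasoning

window-injective : ∀ L .{{_ : NonZero L}} {z x y} → z ≤ x → z ≤ y → x < z + L → y < z + L →
  x % L ≡ y % L → x ≡ y
window-injective L {z} {x} {y} z≤x z≤y x<z+L y<z+L same-rem with <-cmp (x / L) (y / L)
... | tri< x/L<y/L _ _ =
  ⊥-elim (n≮n y (<-≤-trans y<z+L
    (≤-trans (+-monoˡ-≤ L z≤x) (quotient-gap L x y same-rem x/L<y/L))))
... | tri> _ _ y/L<x/L =
  ⊥-elim (n≮n x (<-≤-trans x<z+L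
    (≤-trans (+-monoˡ-≤ L z≤y) (quotient-gap L y x (sym same-rem) y/L<x/L))))
... | tri≈ _ same-quot _ = begin
  x                 ≡⟨ m≡m%n+[m/n]*n x L ⟩
  x % L + x / L * L ≡⟨ cong₂ (λ r q → r + q * L) same-rem same-quot ⟩
  y % L + y / L * L ≡⟨ sym (m≡m%n+[m/n]*n y L) ⟩
  y                 ∎
  where open ≡-Reasoning

modN-< : ∀ L .{{_ : NonZero L}} x → modN L x < L
modN-< (suc L) x = m%n<n x (suc L)

modN-small : ∀ L x → x < L → modN L x ≡ x
modN-small (suc L) x x<L = m<n⇒m%n≡m x<L

modN-+L : ∀ L x → modN L (x + L) ≡ modN L x
modN-+L zero    x = +-identityʳ x
modN-+L (suc L) x = [m+n]%n≡m%n x (suc L)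

modN-window : ∀ L {z x y} → z ≤ x → z ≤ y → x < z + L → y < z + L → modN L x ≡ modN L y → x ≡ y
modN-window zero    _   _   _     _     same = same
modN-window (suc L) z≤x z≤y x<z+L y<z+L same = window-injective (suc L) z≤x z≤y x<z+L y<z+L same

%-offset : ∀ D .{{_ : NonZero D}} r i → r < D → (r + i * D) % D ≡ r
%-offset D r i r<D = trans ([m+kn]%n≡m%n r i D) (m<n⇒m%n≡m r<D)

/-offset : ∀ D .{{_ : NonZero D}} r i → r < D → (r + i * D) / D ≡ i
/-offset D r i r<D = begin
  (r + i * D) / D   ≡⟨ +-distrib-/-∣ʳ r (divides-refl i) ⟩
  r / D + i * D / D ≡⟨ cong₂ _+_ (m<n⇒m/n≡0 r<D) (m*n/n≡m i D) ⟩
  i                 ∎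
  where open ≡-Reasoning

even-or-odd : ∀ t → Σ ℕ λ i → t ≡ 2 * i ⊎ t ≡ suc (2 * i)
even-or-odd zero = 0 , inj₁ refl
even-or-odd (suc t) with even-or-odd t
... | i , inj₁ t≡2i   = i , inj₂ (cong suc t≡2i)
... | i , inj₂ t≡2i+1 = suc i , inj₁ (trans (cong suc t≡2i+1) (2+2i i))
  where
  2+2i : ∀ i → suc (suc (2 * i)) ≡ 2 * suc i
  2+2i = solve-∀

half-bound : ∀ q m → suc (2 * q) ≤ m → q < (m + 1) / 2
half-bound q m 2q+1≤m = begin
  suc q             ≡⟨ sym (m*n/n≡m (suc q) 2) ⟩
  suc q * 2 / 2     ≤⟨ /-monoˡ-≤ 2 (≤-trans (≤-reflexive (double q)) (+-monoˡ-≤ 1 2q+1≤m)) ⟩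
  (m + 1) / 2       ∎
  where
  open ≤-Reasoning
  double : ∀ q → suc q * 2 ≡ suc (2 * q) + 1
  double = solve-∀

all-blue-or-some-red : (colour : ℕ → Colour) → ∀ u →
  (∀ t → t < u → colour t ≡ blue) ⊎ Σ ℕ λ t → t < u × colour t ≡ red
all-blue-or-some-red colour zero = inj₁ (λ t ())
all-blue-or-some-red colour (suc u) with all-blue-or-some-red colour u | colour u in colour-u
... | inj₂ (t , t<u , red-t) | _    = inj₂ (t , m<n⇒m<1+n t<u , red-t)
... | inj₁ _                 | red  = inj₂ (u , ≤-refl , colour-u)
... | inj₁ below-blue        | blue =
  inj₁ λ t t≤u → [ below-blue t , (λ { refl → colour-u }) ]′ (m≤n⇒m<n∨m≡n (s≤s⁻¹ t≤u))

regroup : ∀ e ρ s x → (e + ρ) * x + s ≡ e * x + s + ρ * x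
regroup = solve-∀

module OpenCycle (d n : ℕ) {{_ : NonZero d}} {{_ : NonZero n}} {N B : ℕ}
  (c : Colouring N) (F : ℕ → Fin N) (F-injective : InjectiveBelow B F)
  (red-cycle : ∀ i → i < n → c (image F (λ s → modN (n * d) (i * d + s)) (suc d)) ≡ red) where

  k : ℕ
  k = suc d

  L : ℕ
  L = n * d

  instance
    L-nonZero : NonZero L
    L-nonZero = m*n≢0 n d

  rotated-edge : ∀ e ρ → e < n → ρ ≤ n → c (image F (λ s → modN L (e * d + s + ρ * d)) k) ≡ red
  rotated-edge e ρ e<n ρ≤n with e + ρ <? n
  ... | yes e+ρ<n = subst (λ E → c E ≡ red)
    (image-cong F F _ _ k λ s _ → cong (F ∘ modN L) (regroup e ρ s d)) (red-cycle (e + ρ) e+ρ<n)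
  ... | no e+ρ≮n = subst (λ E → c E ≡ red)
    (image-cong F F _ _ k λ s _ → cong F (wrap s)) (red-cycle (e + ρ ∸ n) wrapped<n)
    where
    n≤e+ρ : n ≤ e + ρ
    n≤e+ρ = ≮⇒≥ e+ρ≮n
    wrapped<n : e + ρ ∸ n < n
    wrapped<n = m<n+o⇒m∸n<o (e + ρ) n (+-mono-<-≤ e<n ρ≤n)
    wrap : ∀ s → modN L ((e + ρ ∸ n) * d + s) ≡ modN L (e * d + s + ρ * d)
    wrap s = begin
      modN L ((e + ρ ∸ n) * d + s)           ≡⟨ modN-+L L _ ⟨
      modN L ((e + ρ ∸ n) * d + s + L)       ≡⟨ cong (modN L) (sym (regroup (e + ρ ∸ n) n s d)) ⟩
      modN L ((e + ρ ∸ n + n) * d + s)       ≡⟨ cong (λ w → modN L (w * d + s)) (m∸n+n≡m n≤e+ρ) ⟩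
      modN L ((e + ρ) * d + s)               ≡⟨ cong (modN L) (regroup e ρ s d) ⟩
      modN L (e * d + s + ρ * d)             ∎
      where open ≡-Reasoning

  -- The cycle read from vertex ρ·d onwards, with the single position q replaced by the
  -- vertex index x: the vertex sequence of the loose paths built below.
  open-at : (q x ρ : ℕ) → ℕ → ℕ
  open-at q x ρ j with j ≟ q
  ... | yes _ = x
  ... | no  _ = modN L (j + ρ * d)

  open-at-q : ∀ q x ρ → open-at q x ρ q ≡ x
  open-at-q q x ρ with q ≟ q
  ... | yes _   = refl
  ... | no q≢q = ⊥-elim (q≢q refl)

  open-at-≢ : ∀ q x ρ j → j ≢ q → open-at q x ρ j ≡ modN L (j + ρ * d)
  open-at-≢ q x ρ j j≢q with j ≟ q
  ... | yes j≡q = ⊥-elim (j≢q j≡q)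
  ... | no  _   = refl

  -- If q is the first or the last of the positions 0, …, L, the others form a window of
  -- length L, on which the rotation j ↦ (j + r) mod L is injective.
  rotation-injective : ∀ {q i j} r → q ≡ 0 ⊎ q ≡ L → i ≤ L → j ≤ L → i ≢ q → j ≢ q →
    modN L (i + r) ≡ modN L (j + r) → i ≡ j
  rotation-injective {i = i} {j} r (inj₁ refl) i≤L j≤L i≢0 j≢0 same =
    +-cancelʳ-≡ r i j (modN-window L (+-monoˡ-≤ r (n≢0⇒n>0 i≢0)) (+-monoˡ-≤ r (n≢0⇒n>0 j≢0))
      (inside i≤L) (inside j≤L) same)
    where
    inside : ∀ {x} → x ≤ L → x + r < suc r + L
    inside {x} x≤L = s≤s (≤-trans (+-monoˡ-≤ r x≤L) (≤-reflexive (+-comm L r)))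
  rotation-injective {i = i} {j} r (inj₂ refl) i≤L j≤L i≢L j≢L same =
    +-cancelʳ-≡ r i j (modN-window L (m≤n+m r i) (m≤n+m r j)
      (inside (≤∧≢⇒< i≤L i≢L)) (inside (≤∧≢⇒< j≤L j≢L)) same)
    where
    inside : ∀ {x} → x < L → x + r < r + L
    inside {x} x<L = subst (x + r <_) (+-comm L r) (+-monoˡ-< r x<L)

  open-at-injective : ∀ {q x} ρ → q ≡ 0 ⊎ q ≡ L → L ≤ x → x < B →
    InjectiveBelow (suc L) (F ∘ open-at q x ρ)
  open-at-injective {q} {x} ρ q∈ends L≤x x<B =
    ∘-injective F (open-at q x ρ) F-injective bound injective
    where
    rotated<x : ∀ j → modN L (j + ρ * d) < x
    rotated<x j = <-≤-trans (modN-< L _) L≤x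
    bound : ∀ j → j < suc L → open-at q x ρ j < B
    bound j _ with j ≟ q
    ... | yes _ = x<B
    ... | no  _ = <-trans (rotated<x j) x<B
    injective : InjectiveOn (suc L) (open-at q x ρ)
    injective i j i≤L j≤L same with i ≟ q | j ≟ q
    ... | yes i≡q | yes j≡q = trans i≡q (sym j≡q)
    ... | yes _   | no  _   = ⊥-elim (<-irrefl (sym same) (rotated<x j))
    ... | no  _   | yes _   = ⊥-elim (<-irrefl same (rotated<x i))
    ... | no  i≢q | no  j≢q =
      rotation-injective (ρ * d) q∈ends (s≤s⁻¹ i≤L) (s≤s⁻¹ j≤L) i≢q j≢q same

  first-replaced : (t x : ℕ) → ℕ → ℕ
  first-replaced t x zero    = x
  first-replaced t x (suc s) = t * d + suc s

  last-replaced : (t x : ℕ) → ℕ → ℕ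
  last-replaced t x s with s ≟ d
  ... | yes _ = x
  ... | no  _ = t * d + s

  last-replaced-d : ∀ t x → last-replaced t x d ≡ x
  last-replaced-d t x with d ≟ d
  ... | yes _   = refl
  ... | no d≢d = ⊥-elim (d≢d refl)

  last-replaced-< : ∀ t x {s} → s < d → last-replaced t x s ≡ t * d + s
  last-replaced-< t x {s} s<d with s ≟ d
  ... | yes refl = ⊥-elim (<-irrefl refl s<d)
  ... | no  _    = refl

  ≤-next-edge : ∀ t {s} → s ≤ d → t * d + s ≤ suc t * d
  ≤-next-edge t s≤d = ≤-trans (+-monoʳ-≤ (t * d) s≤d) (≤-reflexive (+-comm (t * d) d))

  <-next-edge : ∀ t {s} → s < d → t * d + s < suc t * d
  <-next-edge t s<d = <-≤-trans (+-monoʳ-< (t * d) s<d) (≤-reflexive (+-comm (t * d) d))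

  -- A red cycle together with a red copy of e_t (t + 1 < n) whose first vertex is replaced
  -- by an outside vertex x yields a red P^k_n: start at x and walk once around the cycle
  -- from t·d + 1.
  red-path-first : ∀ t x → suc t < n → L ≤ x → x < B →
    c (image F (first-replaced t x) k) ≡ red → HasLoosePath c red k n
  red-path-first t x 1+t<n L≤x x<B red-pendant =
    F ∘ open-at 0 x t , open-at-injective t (inj₁ refl) L≤x x<B , red-edge
    where
    first-edge : ∀ s → s < k → F (first-replaced t x s) ≡ F (open-at 0 x t s)
    first-edge zero    _   = refl
    first-edge (suc s) s<k = cong F (sym (begin
      open-at 0 x t (suc s)    ≡⟨ open-at-≢ 0 x t (suc s) (λ ()) ⟩
      modN L (suc s + t * d)   ≡⟨ cong (modN L) (+-comm (suc s) (t * d)) ⟩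
      modN L (t * d + suc s)   ≡⟨ modN-small L _
                                    (≤-<-trans (≤-next-edge t (s≤s⁻¹ s<k)) (*-monoˡ-< d 1+t<n)) ⟩
      t * d + suc s            ∎))
      where open ≡-Reasoning
    red-edge : ∀ e → e < n → c (image (F ∘ open-at 0 x t) (λ s → e * d + s) k) ≡ red
    red-edge zero    _   = subst (λ E → c E ≡ red)
      (image-cong F (F ∘ open-at 0 x t) _ _ k first-edge) red-pendant
    red-edge (suc e) e<n = subst (λ E → c E ≡ red)
      (image-cong F (F ∘ open-at 0 x t) _ _ k rotated)
      (rotated-edge (suc e) t e<n (<⇒≤ (<-trans (n<1+n t) 1+t<n)))
      where
      rotated : ∀ s → s < k → F (modN L (suc e * d + s + t * d)) ≡ F (open-at 0 x t (suc e * d + s))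
      rotated s _ = cong F (sym (open-at-≢ 0 x t _ (>⇒≢ after-first)))
        where
        after-first : 0 < suc e * d + s
        after-first = <-≤-trans (>-nonZero⁻¹ d) (≤-trans (m≤m+n d (e * d)) (m≤m+n _ s))

  -- A red cycle together with a red copy of e_t (t < n) whose last vertex is replaced by an
  -- outside vertex x yields a red P^k_n: walk once around the cycle from (t+1)·d, reaching
  -- t·d + d - 1 at position L - 1, and end at x.
  red-path-last : ∀ t x → t < n → L ≤ x → x < B →
    c (image F (last-replaced t x) k) ≡ red → HasLoosePath c red k n
  red-path-last t x t<n L≤x x<B red-pendant =
    F ∘ open-at L x (suc t) , open-at-injective (suc t) (inj₂ refl) L≤x x<B , red-edge
    where
    wrap : ∀ e s → e * d + s + suc t * d ≡ t * d + s + suc e * d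
    wrap e s = wrap-identity e t s d
      where
      wrap-identity : ∀ e t s x → e * x + s + suc t * x ≡ t * x + s + suc e * x
      wrap-identity = solve-∀
    red-edge : ∀ e → e < n → c (image (F ∘ open-at L x (suc t)) (λ s → e * d + s) k) ≡ red
    red-edge e e<n with m≤n⇒m<n∨m≡n e<n
    ... | inj₁ 1+e<n = subst (λ E → c E ≡ red)
      (image-cong F (F ∘ open-at L x (suc t)) _ _ k rotated) (rotated-edge e (suc t) e<n t<n)
      where
      rotated : ∀ s → s < k → F (modN L (e * d + s + suc t * d)) ≡ F (open-at L x (suc t) (e * d + s))
      rotated s s<k = cong F (sym (open-at-≢ L x (suc t) _
        (<⇒≢ (≤-<-trans (≤-next-edge e (s≤s⁻¹ s<k)) (*-monoˡ-< d 1+e<n)))))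
    ... | inj₂ refl = subst (λ E → c E ≡ red)
      (image-cong F (F ∘ open-at L x (suc t)) _ _ k last-edge) red-pendant
      where
      last-edge : ∀ s → s < k → F (last-replaced t x s) ≡ F (open-at L x (suc t) (e * d + s))
      last-edge s s<k with s ≟ d
      ... | yes refl = cong F (sym (trans (cong (open-at L x (suc t)) (+-comm (e * d) d)) (open-at-q L x (suc t))))
      ... | no  s≢d  = cong F (sym (begin
        open-at L x (suc t) (e * d + s)  ≡⟨ open-at-≢ L x (suc t) _ (<⇒≢ (<-next-edge e s<d)) ⟩
        modN L (e * d + s + suc t * d)   ≡⟨ cong (modN L) (wrap e s) ⟩
        modN L (t * d + s + L)           ≡⟨ modN-+L L _ ⟩
        modN L (t * d + s)               ≡⟨ modN-small L _
                                              (<-≤-trans (<-next-edge t s<d) (*-monoˡ-≤ d t<n)) ⟩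
        t * d + s                        ∎))
        where
        open ≡-Reasoning
        s<d : s < d
        s<d = ≤∧≢⇒< (s≤s⁻¹ s<k) s≢d

-- Where the vertices of the edges e_{2i}, e_{2i+1} of a loose path sit relative to D = 2x.
even-position : ∀ i s x → 2 * i * x + s ≡ s + i * (2 * x)
even-position = solve-∀

odd-position : ∀ i s x → suc (2 * i) * x + s ≡ (x + s) + i * (2 * x)
odd-position = solve-∀

odd-end-position : ∀ i x → suc (2 * i) * x + x ≡ 0 + suc i * (2 * x)
odd-end-position = solve-∀

joint-position : ∀ i x → x + i * (2 * x) ≡ suc (2 * i) * x
joint-position = solve-∀

module Weave (d n m : ℕ) {{_ : NonZero d}} (1≤m : 1 ≤ m) (m≤n : m ≤ n) {N : ℕ}
  (c : Colouring N) (F : ℕ → Fin N)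
  (F-injective : InjectiveBelow (n * d + (m + 1) / 2) F)
  (red-cycle : ∀ i → i < n → c (image F (λ s → modN (n * d) (i * d + s)) (suc d)) ≡ red) where

  instance
    n-nonZero : NonZero n
    n-nonZero = >-nonZero (≤-trans 1≤m m≤n)

  open OpenCycle d n c F F-injective red-cycle

  p : ℕ
  p = (m + 1) / 2

  D : ℕ
  D = 2 * d

  instance
    D-nonZero : NonZero D
    D-nonZero = m*n≢0 2 d

  d<D : d < D
  d<D = subst (d <_) (cong (d +_) (sym (+-identityʳ d))) (m<m+n d (>-nonZero⁻¹ d))

  md≤L : m * d ≤ L
  md≤L = *-monoˡ-≤ d m≤n

  -- The joints j ≡ d (mod D), between e_{2i} and e_{2i+1}, are exactly the positions d + i·D.
  joint-decomposition : ∀ j → j % D ≡ d → j ≡ d + j / D * D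
  joint-decomposition j j≡d = trans (m≡m%n+[m/n]*n j D) (cong (_+ j / D * D) j≡d)

  -- The candidate blue path: position j of P^k_m goes to the cycle vertex j, except that the
  -- joint d + i·D goes to the new vertex L + i, and (for even m) the end m·d goes to the
  -- vacated joint (m-1)·d.
  weave : ℕ → ℕ
  weave j with j % D ≟ d
  ... | yes _ = L + j / D
  ... | no  _ with j ≟ m * d
  ...   | yes _ = (m ∸ 1) * d
  ...   | no  _ = j

  unweave : ℕ → ℕ
  unweave v with L ≤? v
  ... | yes _ = d + (v ∸ L) * D
  ... | no  _ with v % D ≟ d
  ...   | yes _ = m * d
  ...   | no  _ = v

  unweave-new : ∀ i → unweave (L + i) ≡ d + i * D
  unweave-new i with L ≤? L + i
  ... | yes _    = cong (λ q → d + q * D) (m+n∸m≡n L i)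
  ... | no  L≰L+i = ⊥-elim (L≰L+i (m≤m+n L i))

  unweave-joint : ∀ v → v < L → v % D ≡ d → unweave v ≡ m * d
  unweave-joint v v<L v≡d with L ≤? v
  ... | yes L≤v = ⊥-elim (<⇒≱ v<L L≤v)
  ... | no  _ with v % D ≟ d
  ...   | yes _   = refl
  ...   | no  v≢d = ⊥-elim (v≢d v≡d)

  unweave-plain : ∀ v → v < L → v % D ≢ d → unweave v ≡ v
  unweave-plain v v<L v≢d with L ≤? v
  ... | yes L≤v = ⊥-elim (<⇒≱ v<L L≤v)
  ... | no  _ with v % D ≟ d
  ...   | yes v≡d = ⊥-elim (v≢d v≡d)
  ...   | no  _   = refl

  residue : ∀ {j} r i → r < D → j ≡ r + i * D → j % D ≡ r
  residue r i r<D refl = %-offset D r i r<D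

  vacated-joint : (m * d) % D ≢ d → ((m ∸ 1) * d) % D ≡ d
  vacated-joint md≢d with even-or-odd m
  ... | zero  , inj₁ m≡0     = ⊥-elim (<-irrefl (sym m≡0) 1≤m)
  ... | suc i , inj₁ m≡2+2i = begin
    ((m ∸ 1) * d) % D          ≡⟨ cong (λ a → ((a ∸ 1) * d) % D) m≡2+2i ⟩
    ((2 * suc i ∸ 1) * d) % D  ≡⟨ cong (λ a → ((a ∸ 1) * d) % D) (double-suc i) ⟩
    (suc (2 * i) * d) % D      ≡⟨ cong (_% D) (joint-position i d) ⟨
    (d + i * D) % D            ≡⟨ %-offset D d i d<D ⟩
    d                          ∎
    where
    open ≡-Reasoning
    double-suc : ∀ i → 2 * suc i ≡ suc (suc (2 * i))
    double-suc = solve-∀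
  ... | i , inj₂ m≡1+2i = ⊥-elim (md≢d (begin
    (m * d) % D            ≡⟨ cong (λ a → (a * d) % D) m≡1+2i ⟩
    (suc (2 * i) * d) % D  ≡⟨ cong (_% D) (joint-position i d) ⟨
    (d + i * D) % D        ≡⟨ %-offset D d i d<D ⟩
    d                      ∎))
    where open ≡-Reasoning

  weave-spec : ∀ j → j ≤ m * d → weave j < L + p × unweave (weave j) ≡ j
  weave-spec j j≤md with j % D ≟ d
  ... | yes j≡d = +-monoʳ-< L (half-bound (j / D) m joint≤m) , (begin
    unweave (L + j / D) ≡⟨ unweave-new (j / D) ⟩
    d + j / D * D       ≡⟨ joint-decomposition j j≡d ⟨
    j                   ∎)
    where
    open ≡-Reasoning
    joint≤m : suc (2 * (j / D)) ≤ m
    joint≤m = *-cancelʳ-≤ _ m d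
      (subst (_≤ m * d) (trans (joint-decomposition j j≡d) (joint-position (j / D) d)) j≤md)
  ... | no j≢d with j ≟ m * d
  ...   | yes refl = ≤-trans (*-monoˡ-< d (m∸1<m)) (≤-trans md≤L (m≤m+n L p)) ,
                     unweave-joint _ (<-≤-trans (*-monoˡ-< d m∸1<m) md≤L) (vacated-joint j≢d)
    where
    m∸1<m : m ∸ 1 < m
    m∸1<m = ∸-monoʳ-< z<s 1≤m
  ...   | no j≢md = ≤-trans j<L (m≤m+n L p) , unweave-plain j j<L j≢d
    where
    j<L : j < L
    j<L = <-≤-trans (≤∧≢⇒< j≤md j≢md) md≤L

  weave-joint : ∀ i → weave (d + i * D) ≡ L + i
  weave-joint i with (d + i * D) % D ≟ d
  ... | yes _   = cong (L +_) (/-offset D d i d<D)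
  ... | no  d≢d = ⊥-elim (d≢d (%-offset D d i d<D))

  weave-plain : ∀ j → j % D ≢ d → j < m * d → weave j ≡ j
  weave-plain j j≢d j<md with j % D ≟ d
  ... | yes j≡d = ⊥-elim (j≢d j≡d)
  ... | no  _ with j ≟ m * d
  ...   | yes j≡md = ⊥-elim (<-irrefl j≡md j<md)
  ...   | no  _    = refl

  weave-end : (m * d) % D ≢ d → weave (m * d) ≡ (m ∸ 1) * d
  weave-end md≢d with (m * d) % D ≟ d
  ... | yes md≡d = ⊥-elim (md≢d md≡d)
  ... | no  _ with m * d ≟ m * d
  ...   | yes _     = refl
  ...   | no  md≢md = ⊥-elim (md≢md refl)

  inner-< : ∀ t {s} → t < m → s < d → t * d + s < m * d
  inner-< t t<m s<d = <-≤-trans (<-next-edge t s<d) (*-monoˡ-≤ d t<m)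

  weave-edge : ℕ → Subset N
  weave-edge t = image (F ∘ weave) (λ s → t * d + s) k

  blue-path : (∀ t → t < m → c (weave-edge t) ≡ blue) → HasLoosePath c blue k m
  blue-path all-blue = F ∘ weave , injective , all-blue
    where
    injective : InjectiveBelow (suc (m * d)) (F ∘ weave)
    injective = ∘-injective F weave F-injective (λ j j≤md → proj₁ (weave-spec j (s≤s⁻¹ j≤md)))
      (left-inverse⇒injective weave unweave (λ j j≤md → proj₂ (weave-spec j (s≤s⁻¹ j≤md))))

  -- An even edge e_{2i} of the candidate is e_{2i} with its last vertex replaced by L + i.
  red-from-even-edge : ∀ i → 2 * i < m → c (weave-edge (2 * i)) ≡ red → HasLoosePath c red k n
  red-from-even-edge i t<m red-edge =
    red-path-last t (L + i) (<-≤-trans t<m m≤n) (m≤m+n L i) (+-monoʳ-< L (half-bound i m t<m))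
      (subst (λ E → c E ≡ red) (image-cong (F ∘ weave) F _ _ k same-vertex) red-edge)
    where
    t : ℕ
    t = 2 * i
    same-vertex : ∀ s → s < k → F (weave (t * d + s)) ≡ F (last-replaced t (L + i) s)
    same-vertex s s<k with s ≟ d
    ... | yes refl = cong F (trans (cong weave (even-position i d d)) (weave-joint i))
    ... | no  s≢d  = cong F (weave-plain _ not-joint (inner-< t t<m s<d))
      where
      s<d : s < d
      s<d = ≤∧≢⇒< (s≤s⁻¹ s<k) s≢d
      not-joint : (t * d + s) % D ≢ d
      not-joint is-joint = <-irrefl (trans (sym (residue s i (<-trans s<d d<D) (even-position i s d))) is-joint) s<d

  odd-start : ∀ i → weave (suc (2 * i) * d + 0) ≡ L + i
  odd-start i = trans (cong weave (trans (odd-position i 0 d) (cong (_+ i * D) (+-identityʳ d)))) (weave-joint i)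

  odd-inner : ∀ i {s} → suc (2 * i) < m → 0 < s → s < d →
    weave (suc (2 * i) * d + s) ≡ suc (2 * i) * d + s
  odd-inner i {s} t<m 0<s s<d = weave-plain _ not-joint (inner-< (suc (2 * i)) t<m s<d)
    where
    d+s<D : d + s < D
    d+s<D = subst (d + s <_) (cong (d +_) (sym (+-identityʳ d))) (+-monoʳ-< d s<d)
    not-joint : (suc (2 * i) * d + s) % D ≢ d
    not-joint is-joint = <-irrefl (sym (+-cancelˡ-≡ d s 0 (trans d+s≡d (sym (+-identityʳ d))))) 0<s
      where
      d+s≡d : d + s ≡ d
      d+s≡d = trans (sym (residue (d + s) i d+s<D (odd-position i s d))) is-joint

  -- The last vertex of an odd edge is a multiple of D, hence not a joint.
  odd-end-not-joint : ∀ i → (suc (2 * i) * d + d) % D ≢ d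
  odd-end-not-joint i is-joint =
    <-irrefl (trans (sym (residue 0 (suc i) 0<D (odd-end-position i d))) is-joint) (>-nonZero⁻¹ d)
    where
    0<D : 0 < D
    0<D = <-trans (>-nonZero⁻¹ d) d<D

  -- An odd edge e_{2i+1} with 2i + 2 < m is e_{2i+1} with its first vertex replaced by L + i.
  red-from-odd-edge : ∀ i → suc (suc (2 * i)) < m → c (weave-edge (suc (2 * i))) ≡ red →
    HasLoosePath c red k n
  red-from-odd-edge i t+1<m red-edge =
    red-path-first t (L + i) (<-≤-trans t+1<m m≤n) (m≤m+n L i) (+-monoʳ-< L (half-bound i m (<⇒≤ t<m)))
      (subst (λ E → c E ≡ red) (image-cong (F ∘ weave) F _ _ k same-vertex) red-edge)
    where
    t : ℕ
    t = suc (2 * i)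
    t<m : t < m
    t<m = <-trans (n<1+n t) t+1<m
    same-vertex : ∀ s → s < k → F (weave (t * d + s)) ≡ F (first-replaced t (L + i) s)
    same-vertex zero    _   = cong F (odd-start i)
    same-vertex (suc s) s<k with m≤n⇒m<n∨m≡n (s≤s⁻¹ s<k)
    ... | inj₁ s+1<d = cong F (odd-inner i t<m z<s s+1<d)
    ... | inj₂ refl  = cong F (weave-plain _ (odd-end-not-joint i) end<md)
      where
      end<md : t * d + suc s < m * d
      end<md = ≤-<-trans (≤-reflexive (+-comm (t * d) d)) (*-monoˡ-< d t+1<m)

  -- If 2i + 2 = m, the last edge of the candidate consists of L + i, the inner vertices of
  -- e_{2i+1} and its first vertex (put at the end): as a set, e_{2i+1} with its last vertex
  -- replaced by L + i.
  red-from-last-edge : ∀ i → suc (suc (2 * i)) ≡ m → c (weave-edge (suc (2 * i))) ≡ red →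
    HasLoosePath c red k n
  red-from-last-edge i t+1≡m red-edge =
    red-path-last t (L + i) (<-≤-trans t<m m≤n) (m≤m+n L i) (+-monoʳ-< L (half-bound i m (<⇒≤ t<m)))
      (subst (λ E → c E ≡ red) (trans (image-cong (F ∘ weave) F _ _ k λ _ _ → refl)
                                      (image-≡ F _ _ k covered covered′)) red-edge)
    where
    t : ℕ
    t = suc (2 * i)
    t<m : t < m
    t<m = subst (t <_) t+1≡m (n<1+n t)
    at-end : t * d + d ≡ m * d
    at-end = trans (+-comm (t * d) d) (cong (_* d) t+1≡m)
    end : weave (t * d + d) ≡ t * d + 0
    end = begin
      weave (t * d + d)   ≡⟨ cong weave at-end ⟩
      weave (m * d)       ≡⟨ weave-end (subst (λ a → a % D ≢ d) at-end (odd-end-not-joint i)) ⟩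
      (m ∸ 1) * d         ≡⟨ cong (λ a → (a ∸ 1) * d) (sym t+1≡m) ⟩
      t * d               ≡⟨ +-identityʳ (t * d) ⟨
      t * d + 0           ∎
      where open ≡-Reasoning
    covered : PositionsCovered k (λ s → weave (t * d + s)) (last-replaced t (L + i))
    covered zero    _ = d , ≤-refl , trans (odd-start i) (sym (last-replaced-d t (L + i)))
    covered (suc s) s<k with m≤n⇒m<n∨m≡n (s≤s⁻¹ s<k)
    ... | inj₁ s+1<d = suc s , s<k , trans (odd-inner i t<m z<s s+1<d) (sym (last-replaced-< t (L + i) s+1<d))
    ... | inj₂ refl  = 0 , z<s , trans end (sym (last-replaced-< t (L + i) (>-nonZero⁻¹ d)))
    covered′ : PositionsCovered k (last-replaced t (L + i)) (λ s → weave (t * d + s))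
    covered′ s s<k with s ≟ d
    ... | yes refl = 0 , z<s , sym (odd-start i)
    covered′ zero    s<k | no _   = d , ≤-refl , sym end
    covered′ (suc s) s<k | no s≢d = suc s , s<k , sym (odd-inner i t<m z<s (≤∧≢⇒< (s≤s⁻¹ s<k) s≢d))

  red-or-blue-path : HasLoosePath c red k n ⊎ HasLoosePath c blue k m
  red-or-blue-path with all-blue-or-some-red (c ∘ weave-edge) m
  ... | inj₁ all-blue = inj₂ (blue-path all-blue)
  ... | inj₂ (t , t<m , red-edge) = inj₁ (red-from-edge t t<m red-edge)
    where
    red-from-edge : ∀ t → t < m → c (weave-edge t) ≡ red → HasLoosePath c red k n
    red-from-edge t t<m red-edge with even-or-odd t
    ... | i , inj₁ refl = red-from-even-edge i t<m red-edge
    ... | i , inj₂ refl with suc t ≟ m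
    ...   | no  t+1≢m = red-from-odd-edge i (≤∧≢⇒< t<m t+1≢m) red-edge
    ...   | yes t+1≡m = red-from-last-edge i t+1≡m red-edge

mainTheorem2 : (k n m : ℕ) → 2 ≤ k → 3 ≤ m → m ≤ n →
    (c : Colouring ((k ∸ 1) * n + (m + 1) / 2)) →
    HasLooseCycle c red k n →
    HasLoosePath c red k n ⊎ HasLoosePath c blue k m
mainTheorem2 (suc (suc d)) n m (s≤s (s≤s z≤n)) 3≤m m≤n c (f , f-injective , f-red)
  with extend-injective (n * suc d) ((m + 1) / 2) f f-injective
         (≤-reflexive (cong (_+ (m + 1) / 2) (*-comm n (suc d))))
... | F , F-injective , F≡f-on-cycle =
  Weave.red-or-blue-path (suc d) n m 1≤m m≤n c F F-injective F-red
  where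
  1≤m : 1 ≤ m
  1≤m = ≤-trans (s≤s z≤n) 3≤m
  instance
    cycle-nonZero : NonZero (n * suc d)
    cycle-nonZero = m*n≢0 n (suc d) {{>-nonZero (≤-trans 1≤m m≤n)}}
  F-red : ∀ i → i < n → c (image F (λ s → modN (n * suc d) (i * suc d + s)) (suc (suc d))) ≡ red
  F-red i i<n = subst (λ E → c E ≡ red)
    (image-cong f F _ _ (suc (suc d)) λ s _ → sym (F≡f-on-cycle _ (modN-< (n * suc d) _))) (f-red i i<n)
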